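{- Let $k>0$ be real and $Q_{k,n}=F_{k,n}+i\,F_{k,n+1}+j\,F_{k,n+2}+ij\,F_{k,n+3}$. For every integer $n\ge1$ and every integer $r\ge0$, $$Q_{k,n+r-1}Q_{k,n+r+1}-(Q_{k,n+r})^2=(-1)^{n+r}\big[\,2(k^2+2)\,j+(k^3+2k)\,ij\,\big].$$
   Context: For a real number $k>0$, the $k$-Fibonacci numbers are $F_{k,0}=0$, $F_{k,1}=1$, $F_{k,n+1}=kF_{k,n}+F_{k,n-1}$. Bicomplex numbers form the real commutative associative algebra with basis $\{1,i,j,ij\}$, $i^2=j^2=-1$, $ij=ji$, $(ij)^2=1$; $Q_{k,n}$ is the bicomplex $k$-Fibonacci quaternion, multiplied in this algebra. -}

module Defs where

open import Level using (_⊔_)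
open import Algebra.Bundles using (CommutativeRing)
open import Data.Nat using (ℕ; zero; suc)
open import Data.Product using (_×_)

-- Bicomplex numbers and k-Fibonacci objects over a commutative ring R
-- (the paper's case is R = ℝ).
module Bicomplex {c ℓ} (R : CommutativeRing c ℓ) where
  open CommutativeRing R

  record BC : Set c where
    constructor mkBC
    field
      re  : Carrier
      cI  : Carrier
      cJ  : Carrier
      cIJ : Carrier
  open BC public

  _≈BC_ : BC → BC → Set ℓ
  x ≈BC y = (re x ≈ re y) × (cI x ≈ cI y) × (cJ x ≈ cJ y) × (cIJ x ≈ cIJ y)

  _-BC_ : BC → BC → BC
  mkBC a b c' d -BC mkBC e f g h = mkBC (a - e) (b - f) (c' - g) (d - h)

  -- multiplication with i² = j² = -1, ij = ji, (ij)² = 1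
  _*BC_ : BC → BC → BC
  mkBC a b c' d *BC mkBC e f g h =
    mkBC (a * e - b * f - c' * g + d * h)
         (a * f + b * e - c' * h - d * g)
         (a * g + c' * e - b * h - d * f)
         (a * h + d * e + b * g + c' * f)

  F : Carrier → ℕ → Carrier
  F k zero = 0#
  F k (suc zero) = 1#
  F k (suc (suc n)) = k * F k (suc n) + F k n

  Q : Carrier → ℕ → BC
  Q k n = mkBC (F k n) (F k (suc n)) (F k (suc (suc n))) (F k (suc (suc (suc n))))

  sgn : ℕ → Carrier
  sgn zero = 1#
  sgn (suc m) = - sgn m

  two : Carrier
  two = 1# + 1#

  rhs : Carrier → ℕ → BC
  rhs k m = mkBC 0# 0# (sgn m * (two * (k * k + two)))
                       (sgn m * (k * k * k + two * k))

-- Write Q_m for the quaternion whose four coefficients are the k-Fibonacci numbers from F_m on;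
-- it is determined by x = F_m and y = F_{m+1}. Expanding the bicomplex product gives the polynomial
-- identity Q_m Q_{m+2} - Q_{m+1}² = C(x, y) [2(k²+2) j + (k³+2k) ij] with C(x, y) = x² + kxy - y².
-- Since C(y, ky + x) = -C(x, y) and C(0, 1) = -1, Cassini's identity C(F_m, F_{m+1}) = (-1)^(m+1)
-- follows, and the theorem is the case m = n + r - 1.
module Submission where

open import Level using (0ℓ)
open import Algebra.Bundles using (CommutativeRing; RawRing)
open import Algebra.Solver.Ring.AlmostCommutativeRing
  using (fromCommutativeRing; _-Raw-AlmostCommutative⟶_)
import Algebra.Solver.Ring as RingSolver
import Algebra.Properties.Ring as RingProperties
import Algebra.Properties.AbelianGroup as AbelianGroupProperties
import Algebra.Properties.CommutativeSemigroup as CommutativeSemigroupProperties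
import Algebra.Properties.Semiring.Mult.TCOptimised as SemiringMultiplication
open import Data.Nat as ℕ using (ℕ; zero; suc)
open import Data.Nat.Properties using (+-suc)
open import Data.Product using (_×_; _,_)
open import Data.Maybe using (Maybe; just; nothing)
open import Relation.Nullary using (yes; no)
open import Relation.Binary.PropositionalEquality as ≡ using (_≡_)
import Relation.Binary.Reasoning.Setoid as SetoidReasoning

open import Defs

-- Algebra.Solver.Ring needs a coefficient ring with (weakly) decidable equality mapping into R;
-- the integers, as formal differences p - q of naturals, map into every commutative ring.
module DifferenceCoefficientSolver {c ℓ} (R : CommutativeRing c ℓ) where
  open CommutativeRing R hiding (zero)
  open RingProperties ring using (x[y-z]≈xy-xz; [y-z]x≈yx-zx)
  open AbelianGroupProperties +-abelianGroup using (⁻¹-∙-comm; ⁻¹-anti-homo‿-; ε⁻¹≈ε)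
  open CommutativeSemigroupProperties +-commutativeSemigroup using (interchange)
  open SemiringMultiplication semiring using (×-homo-+; ×1-homo-*) renaming (_×_ to _·_)
  open SetoidReasoning setoid

  x-0#≈x : ∀ x → x - 0# ≈ x
  x-0#≈x x = trans (+-congˡ ε⁻¹≈ε) (+-identityʳ x)

  +-‿interchange : ∀ a b c d → (a + b) - (c + d) ≈ (a - c) + (b - d)
  +-‿interchange a b c d = trans (+-congˡ (sym (⁻¹-∙-comm c d))) (interchange a b (- c) (- d))

  [x-y][u-v]≈[xu+yv]-[xv+yu] : ∀ x y u v → (x - y) * (u - v) ≈ (x * u + y * v) - (x * v + y * u)
  [x-y][u-v]≈[xu+yv]-[xv+yu] x y u v = begin
    (x - y) * (u - v)                         ≈⟨ [y-z]x≈yx-zx (u - v) x y ⟩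
    x * (u - v) - y * (u - v)                 ≈⟨ +-cong (x[y-z]≈xy-xz x u v) (-‿cong (x[y-z]≈xy-xz y u v)) ⟩
    (x * u - x * v) - (y * u - y * v)         ≈⟨ +-congˡ (⁻¹-anti-homo‿- (y * u) (y * v)) ⟩
    (x * u - x * v) + (y * v - y * u)         ≈⟨ interchange (x * u) (- (x * v)) (y * v) (- (y * u)) ⟩
    (x * u + y * v) + (- (x * v) + - (y * u)) ≈⟨ +-congˡ (⁻¹-∙-comm (x * v) (y * u)) ⟩
    (x * u + y * v) - (x * v + y * u)         ∎

  x+w≈u+y⇒x-y≈u-w : ∀ x y u w → x + w ≈ u + y → x - y ≈ u - w
  x+w≈u+y⇒x-y≈u-w x y u w eq = begin
    x - y              ≈⟨ +-identityʳ (x - y) ⟨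
    (x - y) + 0#       ≈⟨ +-congˡ (-‿inverseʳ w) ⟨
    (x - y) + (w - w)  ≈⟨ +-‿interchange x w y w ⟨
    (x + w) - (y + w)  ≈⟨ +-cong eq (-‿cong (+-comm y w)) ⟩
    (u + y) - (w + y)  ≈⟨ +-‿interchange u y w y ⟩
    (u - w) + (y - y)  ≈⟨ +-congˡ (-‿inverseʳ y) ⟩
    (u - w) + 0#       ≈⟨ +-identityʳ (u - w) ⟩
    u - w              ∎

  p+q′≡p′+q⇒p-q≈p′-q′ : ∀ p q p′ q′ → p ℕ.+ q′ ≡ p′ ℕ.+ q → p · 1# - q · 1# ≈ p′ · 1# - q′ · 1#
  p+q′≡p′+q⇒p-q≈p′-q′ p q p′ q′ eq = x+w≈u+y⇒x-y≈u-w (p · 1#) (q · 1#) (p′ · 1#) (q′ · 1#) (begin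
    p · 1# + q′ · 1#     ≈⟨ ×-homo-+ 1# p q′ ⟨
    (p ℕ.+ q′) · 1#      ≡⟨ ≡.cong (_· 1#) eq ⟩
    (p′ ℕ.+ q) · 1#      ≈⟨ ×-homo-+ 1# p′ q ⟩
    p′ · 1# + q · 1#     ∎)

  -- Results are reduced to the form (p , 0) or (0 , q): the solver compares normal forms
  -- definitionally, so equal coefficients must be represented identically.
  _⊖_ : ℕ → ℕ → ℕ × ℕ
  zero  ⊖ q     = zero , q
  suc p ⊖ zero  = suc p , zero
  suc p ⊖ suc q = p ⊖ q

  ℕ²-rawRing : RawRing 0ℓ 0ℓ
  ℕ²-rawRing = record
    { Carrier = ℕ × ℕ
    ; _≈_     = _≡_
    ; _+_     = λ { (p , q) (p′ , q′) → (p ℕ.+ p′) ⊖ (q ℕ.+ q′) }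
    ; _*_     = λ { (p , q) (p′ , q′) → (p ℕ.* p′ ℕ.+ q ℕ.* q′) ⊖ (p ℕ.* q′ ℕ.+ q ℕ.* p′) }
    ; -_      = λ { (p , q) → (q , p) }
    ; 0#      = (0 , 0)
    ; 1#      = (1 , 0)
    }

  -- The case q = 0 is separate so that the constants (0 , 0), (1 , 0) and (2 , 0) denote
  -- 0#, 1# and 1# + 1# definitionally, as they appear in the goals.
  difference : ℕ × ℕ → Carrier
  difference (p , zero)  = p · 1#
  difference (p , suc q) = p · 1# - suc q · 1#

  difference≈p-q : ∀ p q → difference (p , q) ≈ p · 1# - q · 1#
  difference≈p-q p zero    = sym (x-0#≈x (p · 1#))
  difference≈p-q p (suc q) = refl

  difference-⊖ : ∀ p q → difference (p ⊖ q) ≈ p · 1# - q · 1#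
  difference-⊖ zero    q       = difference≈p-q zero q
  difference-⊖ (suc p) zero    = difference≈p-q (suc p) zero
  difference-⊖ (suc p) (suc q) = trans (difference-⊖ p q) (p+q′≡p′+q⇒p-q≈p′-q′ p q (suc p) (suc q) (+-suc p q))

  difference-homo-+ : ∀ p q p′ q′ →
    difference ((p ℕ.+ p′) ⊖ (q ℕ.+ q′)) ≈ difference (p , q) + difference (p′ , q′)
  difference-homo-+ p q p′ q′ = begin
    difference ((p ℕ.+ p′) ⊖ (q ℕ.+ q′))       ≈⟨ difference-⊖ (p ℕ.+ p′) (q ℕ.+ q′) ⟩
    (p ℕ.+ p′) · 1# - (q ℕ.+ q′) · 1#          ≈⟨ +-cong (×-homo-+ 1# p p′) (-‿cong (×-homo-+ 1# q q′)) ⟩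
    (p · 1# + p′ · 1#) - (q · 1# + q′ · 1#)    ≈⟨ +-‿interchange (p · 1#) (p′ · 1#) (q · 1#) (q′ · 1#) ⟩
    (p · 1# - q · 1#) + (p′ · 1# - q′ · 1#)    ≈⟨ +-cong (difference≈p-q p q) (difference≈p-q p′ q′) ⟨
    difference (p , q) + difference (p′ , q′)  ∎

  difference-homo-* : ∀ p q p′ q′ →
    difference ((p ℕ.* p′ ℕ.+ q ℕ.* q′) ⊖ (p ℕ.* q′ ℕ.+ q ℕ.* p′)) ≈ difference (p , q) * difference (p′ , q′)
  difference-homo-* p q p′ q′ = begin
    difference ((p ℕ.* p′ ℕ.+ q ℕ.* q′) ⊖ (p ℕ.* q′ ℕ.+ q ℕ.* p′))
      ≈⟨ difference-⊖ (p ℕ.* p′ ℕ.+ q ℕ.* q′) (p ℕ.* q′ ℕ.+ q ℕ.* p′) ⟩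
    (p ℕ.* p′ ℕ.+ q ℕ.* q′) · 1# - (p ℕ.* q′ ℕ.+ q ℕ.* p′) · 1#
      ≈⟨ +-cong (·1#-homo-+-* p p′ q q′) (-‿cong (·1#-homo-+-* p q′ q p′)) ⟩
    (p · 1# * p′ · 1# + q · 1# * q′ · 1#) - (p · 1# * q′ · 1# + q · 1# * p′ · 1#)
      ≈⟨ [x-y][u-v]≈[xu+yv]-[xv+yu] (p · 1#) (q · 1#) (p′ · 1#) (q′ · 1#) ⟨
    (p · 1# - q · 1#) * (p′ · 1# - q′ · 1#)
      ≈⟨ *-cong (difference≈p-q p q) (difference≈p-q p′ q′) ⟨
    difference (p , q) * difference (p′ , q′)
      ∎
    where
    ·1#-homo-+-* : ∀ a b c d → (a ℕ.* b ℕ.+ c ℕ.* d) · 1# ≈ a · 1# * b · 1# + c · 1# * d · 1#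
    ·1#-homo-+-* a b c d = trans (×-homo-+ 1# (a ℕ.* b) (c ℕ.* d)) (+-cong (×1-homo-* a b) (×1-homo-* c d))

  difference-homo-‿ : ∀ p q → difference (q , p) ≈ - difference (p , q)
  difference-homo-‿ p q = begin
    difference (q , p)   ≈⟨ difference≈p-q q p ⟩
    q · 1# - p · 1#      ≈⟨ ⁻¹-anti-homo‿- (p · 1#) (q · 1#) ⟨
    - (p · 1# - q · 1#)  ≈⟨ -‿cong (difference≈p-q p q) ⟨
    - difference (p , q) ∎

  homomorphism : ℕ²-rawRing -Raw-AlmostCommutative⟶ fromCommutativeRing R
  homomorphism = record
    { ⟦_⟧    = difference
    ; +-homo = λ { (p , q) (p′ , q′) → difference-homo-+ p q p′ q′ }
    ; *-homo = λ { (p , q) (p′ , q′) → difference-homo-* p q p′ q′ }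
    ; -‿homo = λ { (p , q) → difference-homo-‿ p q }
    ; 0-homo = refl
    ; 1-homo = refl
    }

  difference-equal? : ∀ x y → Maybe (difference x ≈ difference y)
  difference-equal? (p , q) (p′ , q′) with p ℕ.+ q′ ℕ.≟ p′ ℕ.+ q
  ... | no _   = nothing
  ... | yes eq = just (begin
    difference (p , q)   ≈⟨ difference≈p-q p q ⟩
    p · 1# - q · 1#      ≈⟨ p+q′≡p′+q⇒p-q≈p′-q′ p q p′ q′ eq ⟩
    p′ · 1# - q′ · 1#    ≈⟨ difference≈p-q p′ q′ ⟨
    difference (p′ , q′) ∎)

  open RingSolver ℕ²-rawRing (fromCommutativeRing R) homomorphism difference-equal? public

module KFibonacciQuaternions {c ℓ} (R : CommutativeRing c ℓ) where
  open CommutativeRing R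
  open Bicomplex R
  open DifferenceCoefficientSolver R using (solve; _:=_; _:+_; _:-_; _:*_; :-_; con; Polynomial)

  cassiniForm : Carrier → Carrier → Carrier → Carrier
  cassiniForm k x y = x * x + k * x * y - y * y

  quaternionFrom : Carrier → Carrier → Carrier → BC
  quaternionFrom k x y = mkBC x y (k * y + x) (k * (k * y + x) + y)

  cassiniTerm : Carrier → Carrier → BC
  cassiniTerm k s = mkBC 0# 0# (s * (two * (k * k + two))) (s * (k * k * k + two * k))

  private
    variable
      n : ℕ

    record BCₚ (n : ℕ) : Set where
      constructor mkBCₚ
      field reₚ cIₚ cJₚ cIJₚ : Polynomial n
    open BCₚ

    cassiniFormₚ : Polynomial n → Polynomial n → Polynomial n → Polynomial n
    cassiniFormₚ k x y = x :* x :+ k :* x :* y :- y :* y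

    quaternionFromₚ : Polynomial n → Polynomial n → Polynomial n → BCₚ n
    quaternionFromₚ k x y = mkBCₚ x y (k :* y :+ x) (k :* (k :* y :+ x) :+ y)

    cassiniTermₚ : Polynomial n → Polynomial n → BCₚ n
    cassiniTermₚ k s = mkBCₚ (con (0 , 0)) (con (0 , 0))
      (s :* (con (2 , 0) :* (k :* k :+ con (2 , 0)))) (s :* (k :* k :* k :+ con (2 , 0) :* k))

    _*ₚ_ : BCₚ n → BCₚ n → BCₚ n
    mkBCₚ a b c′ d *ₚ mkBCₚ e f g h =
      mkBCₚ (a :* e :- b :* f :- c′ :* g :+ d :* h)
            (a :* f :+ b :* e :- c′ :* h :- d :* g)
            (a :* g :+ c′ :* e :- b :* h :- d :* f)
            (a :* h :+ d :* e :+ b :* g :+ c′ :* f)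

    _-ₚ_ : BCₚ n → BCₚ n → BCₚ n
    mkBCₚ a b c′ d -ₚ mkBCₚ e f g h = mkBCₚ (a :- e) (b :- f) (c′ :- g) (d :- h)

    cassiniDifferenceₚ : Polynomial n → Polynomial n → Polynomial n → BCₚ n
    cassiniDifferenceₚ {n} k x y =
      (quaternionFromₚ k x y *ₚ quaternionFromₚ k z (k :* z :+ y)) -ₚ (quaternionFromₚ k y z *ₚ quaternionFromₚ k y z)
      where
      z : Polynomial n
      z = k :* y :+ x

  cassiniForm-step : ∀ k x y → cassiniForm k y (k * y + x) ≈ - cassiniForm k x y
  cassiniForm-step = solve 3 (λ k x y → cassiniFormₚ k y (k :* y :+ x) := :- cassiniFormₚ k x y) refl

  cassiniForm-0-1 : ∀ k → cassiniForm k 0# 1# ≈ - 1#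
  cassiniForm-0-1 = solve 1 (λ k → cassiniFormₚ k (con (0 , 0)) (con (1 , 0)) := :- con (1 , 0)) refl

  cassini : ∀ k n → cassiniForm k (F k n) (F k (suc n)) ≈ sgn (suc n)
  cassini k zero    = cassiniForm-0-1 k
  cassini k (suc n) = trans (cassiniForm-step k (F k n) (F k (suc n))) (-‿cong (cassini k n))

  quaternionFrom-cassini : ∀ k x y → let z = k * y + x in
    ((quaternionFrom k x y *BC quaternionFrom k z (k * z + y)) -BC (quaternionFrom k y z *BC quaternionFrom k y z))
      ≈BC cassiniTerm k (cassiniForm k x y)
  quaternionFrom-cassini k x y =
    solve 3 (λ k x y → reₚ  (cassiniDifferenceₚ k x y) := reₚ  (cassiniTermₚ k (cassiniFormₚ k x y))) refl k x y ,
    solve 3 (λ k x y → cIₚ  (cassiniDifferenceₚ k x y) := cIₚ  (cassiniTermₚ k (cassiniFormₚ k x y))) refl k x y ,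
    solve 3 (λ k x y → cJₚ  (cassiniDifferenceₚ k x y) := cJₚ  (cassiniTermₚ k (cassiniFormₚ k x y))) refl k x y ,
    solve 3 (λ k x y → cIJₚ (cassiniDifferenceₚ k x y) := cIJₚ (cassiniTermₚ k (cassiniFormₚ k x y))) refl k x y

  cassiniTerm-cong : ∀ k {s t} → s ≈ t → cassiniTerm k s ≈BC cassiniTerm k t
  cassiniTerm-cong k s≈t = refl , refl , *-congʳ s≈t , *-congʳ s≈t

  ≈BC-trans : ∀ {x y z} → x ≈BC y → y ≈BC z → x ≈BC z
  ≈BC-trans (p , q , r , s) (p′ , q′ , r′ , s′) = trans p p′ , trans q q′ , trans r r′ , trans s s′

  -- Q k m is quaternionFrom k (F k m) (F k (suc m)) and rhs k m is cassiniTerm k (sgn m), definitionally.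
  Q-cassini : ∀ k m → ((Q k m *BC Q k (suc (suc m))) -BC (Q k (suc m) *BC Q k (suc m))) ≈BC rhs k (suc m)
  Q-cassini k m = ≈BC-trans (quaternionFrom-cassini k (F k m) (F k (suc m))) (cassiniTerm-cong k (cassini k m))

open import Data.Nat using (_+_; _∸_; _≤_)
open import Data.Nat.Properties using (+-comm)

mainTheorem9 : ∀ {c ℓ} (R : CommutativeRing c ℓ) (k : CommutativeRing.Carrier R) (n r : ℕ) → 1 ≤ n →
    let open Bicomplex R in
    ((Q k (n + r ∸ 1) *BC Q k (n + r + 1)) -BC (Q k (n + r) *BC Q k (n + r))) ≈BC rhs k (n + r)
mainTheorem9 R k (suc n) r _ rewrite +-comm (n + r) 1 = KFibonacciQuaternions.Q-cassini R k (n + r)
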